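{- If $H$ is a linear hypergraph in which every hyperedge has cardinality at least $r$ and which has at least $r$ hyperedges, then $b_L(H)\ge\binom{r}{2}$.
   Context: A hypergraph $H$ consists of a finite vertex set $V(H)$ and a finite collection $E(H)$ of subsets of $V(H)$; it is linear if every two distinct hyperedges intersect in at most one vertex. Lazy burning: a set $B\subseteq V(H)$ is burned initially; in each subsequent round every unburned vertex $v$ for which some hyperedge $h\ni v$ has $h\setminus\{v\}$ entirely burned becomes burned. $B$ is a lazy burning set if eventually all vertices burn; $b_L(H)$ is the minimum size of a lazy burning set. -}

module Defs where

open import Data.Nat using (ℕ; zero; suc; _≤_)
open import Data.Fin using (Fin)
open import Data.Fin.Subset using (Subset; _∈_; _∉_; _∩_; ∣_∣)
open import Data.Product using (Σ; _×_)
open import Data.Sum using (_⊎_)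
open import Relation.Binary.PropositionalEquality using (_≢_)

record Hypergraph : Set where
  field
    n     : ℕ
    m     : ℕ
    edge  : Fin m → Subset n

open Hypergraph public

Linear : Hypergraph → Set
Linear H = ∀ (i j : Fin (m H)) → i ≢ j → ∣ edge H i ∩ edge H j ∣ ≤ 1

BurnedAt : (H : Hypergraph) → Subset (n H) → ℕ → Fin (n H) → Set
BurnedAt H B zero    v = v ∈ B
BurnedAt H B (suc t) v =
  BurnedAt H B t v
  ⊎ Σ (Fin (m H)) (λ i → (v ∈ edge H i)
      × (∀ (u : Fin (n H)) → u ∈ edge H i → u ≢ v → BurnedAt H B t u))

IsLazyBurningSet : (H : Hypergraph) → Subset (n H) → Set
IsLazyBurningSet H B = Σ ℕ (λ t → ∀ (v : Fin (n H)) → BurnedAt H B t v)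

LazyBurningNumber≥ : Hypergraph → ℕ → Set
LazyBurningNumber≥ H k = ∀ (B : Subset (n H)) → IsLazyBurningSet H B → k ≤ ∣ B ∣

module Submission where

-- Run the burning process deterministically: in each round, add every vertex of every edge
-- having at most one vertex outside the burned set S. Each such edge contributes at most one new
-- vertex and is full afterwards, so |S| ≤ |B| + #(edges inside S) holds in every round. At the
-- round in which the number of full edges first reaches r, this yields r edges spanning at most
-- |B| + r vertices. In a linear hypergraph r edges of size ≥ r span at least
-- r·r − C(r,2) = r + C(r,2) vertices, since each edge meets each earlier one at most once.
-- Hence C(r,2) ≤ |B|.

open import Defs
open import Data.Nat using (ℕ; zero; suc; _+_; _*_; _≤_; z≤n; s≤s; _≤?_)
open import Data.Nat.Properties
open import Data.Nat.Combinatorics using (_C_; nC1≡n; nCk+nC[k+1]≡[n+1]C[k+1])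
open import Data.Nat.Solver using (module +-*-Solver)
open import Data.Bool using (true; false)
open import Data.Bool.Properties using (T-≡)
open import Data.Fin using (Fin; zero; suc)
import Data.Fin.Properties as Fin
open import Data.Fin.Subset using (Subset; Empty; _∈_; _∉_; _∩_; _∪_; _─_; _⊆_; ⊥; ⊤; ⁅_⁆; ∣_∣)
open import Data.Fin.Subset.Properties
  using ( drop-∷-⊆; in⊆in; out⊆; ⊥⊆; ∉⊥; ∣⊥∣≡0; ∣⊤∣≡n; p⊆q⇒∣p∣≤∣q∣; Empty-unique; _⊆?_; ⊆-antisym
        ; x∈p∩q⁺; x∈p∩q⁻; x∈p∪q⁺; x∈p∪q⁻; q⊆p∪q; ∣q∣≤∣p∪q∣
        ; x∈p∧x∉q⇒x∈p─q; p─q⊆p; p─⊥≡p; x∈⁅x⁆; ∣⁅x⁆∣≡1)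
open import Data.Vec using ([]; _∷_; here; there; tabulate)
open import Data.Vec.Properties using (lookup∘tabulate; []=⇒lookup; lookup⇒[]=)
open import Data.Product using (Σ; _×_; _,_)
open import Data.Sum using (inj₁; inj₂; [_,_]′)
open import Data.Empty using (⊥-elim)
open import Function using (_∘_; Equivalence)
open import Level using (Level)
open import Relation.Nullary using (yes; no)
open import Relation.Nullary.Decidable using (isYes; toWitness; fromWitness)
open import Relation.Unary using (Pred; Decidable)
open import Relation.Binary.PropositionalEquality

private variable
  k m′ : ℕ
  ℓ : Level

∣p∪q∣+∣p∩q∣≡∣p∣+∣q∣ : (p q : Subset k) → ∣ p ∪ q ∣ + ∣ p ∩ q ∣ ≡ ∣ p ∣ + ∣ q ∣
∣p∪q∣+∣p∩q∣≡∣p∣+∣q∣ []          []          = refl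
∣p∪q∣+∣p∩q∣≡∣p∣+∣q∣ (true ∷ p)  (true ∷ q)  =
  cong suc (trans (+-suc _ _) (trans (cong suc (∣p∪q∣+∣p∩q∣≡∣p∣+∣q∣ p q)) (sym (+-suc _ _))))
∣p∪q∣+∣p∩q∣≡∣p∣+∣q∣ (true ∷ p)  (false ∷ q) = cong suc (∣p∪q∣+∣p∩q∣≡∣p∣+∣q∣ p q)
∣p∪q∣+∣p∩q∣≡∣p∣+∣q∣ (false ∷ p) (true ∷ q)  =
  trans (cong suc (∣p∪q∣+∣p∩q∣≡∣p∣+∣q∣ p q)) (sym (+-suc _ _))
∣p∪q∣+∣p∩q∣≡∣p∣+∣q∣ (false ∷ p) (false ∷ q) = ∣p∪q∣+∣p∩q∣≡∣p∣+∣q∣ p q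

∣p∪q∣≤∣p∣+∣q∣ : (p q : Subset k) → ∣ p ∪ q ∣ ≤ ∣ p ∣ + ∣ q ∣
∣p∪q∣≤∣p∣+∣q∣ p q = ≤-trans (m≤m+n _ _) (≤-reflexive (∣p∪q∣+∣p∩q∣≡∣p∣+∣q∣ p q))

∣p∪q∣≡∣p∣+∣q─p∣ : (p q : Subset k) → ∣ p ∪ q ∣ ≡ ∣ p ∣ + ∣ q ─ p ∣
∣p∪q∣≡∣p∣+∣q─p∣ []          []          = refl
∣p∪q∣≡∣p∣+∣q─p∣ (true ∷ p)  (_ ∷ q)     = cong suc (∣p∪q∣≡∣p∣+∣q─p∣ p q)
∣p∪q∣≡∣p∣+∣q─p∣ (false ∷ p) (true ∷ q)  = trans (cong suc (∣p∪q∣≡∣p∣+∣q─p∣ p q)) (sym (+-suc _ _))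
∣p∪q∣≡∣p∣+∣q─p∣ (false ∷ p) (false ∷ q) = ∣p∪q∣≡∣p∣+∣q─p∣ p q

p⊆q⇒∣q∣≡∣p∣+∣q─p∣ : (p q : Subset k) → p ⊆ q → ∣ q ∣ ≡ ∣ p ∣ + ∣ q ─ p ∣
p⊆q⇒∣q∣≡∣p∣+∣q─p∣ p q p⊆q = trans (cong ∣_∣ (sym p∪q≡q)) (∣p∪q∣≡∣p∣+∣q─p∣ p q)
  where
  p∪q≡q : p ∪ q ≡ q
  p∪q≡q = ⊆-antisym (λ x∈ → [ p⊆q , (λ x∈q → x∈q) ]′ (x∈p∪q⁻ p q x∈)) (q⊆p∪q p q)

x∈p─q⇒x∉q : (p q : Subset k) {x : Fin k} → x ∈ p ─ q → x ∉ q
x∈p─q⇒x∉q (true ∷ p)  (false ∷ q) here       = λ ()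
x∈p─q⇒x∉q (_ ∷ p)     (_ ∷ q)     (there x∈) = λ { (there x∈q) → x∈p─q⇒x∉q p q x∈ x∈q }
x∈p─q⇒x∉q (false ∷ p) (true ∷ q)  {zero} ()
x∈p─q⇒x∉q (false ∷ p) (false ∷ q) {zero} ()

p⊆q⇒∣p─q∣≡0 : (p q : Subset k) → p ⊆ q → ∣ p ─ q ∣ ≡ 0
p⊆q⇒∣p─q∣≡0 {k} p q p⊆q = trans (cong ∣_∣ (Empty-unique no-element)) (∣⊥∣≡0 k)
  where
  no-element : Empty (p ─ q)
  no-element (x , x∈) = x∈p─q⇒x∉q p q x∈ (p⊆q (p─q⊆p p q x∈))

⊆-between : (p q : Subset k) {r : ℕ} → p ⊆ q → ∣ p ∣ ≤ r → r ≤ ∣ q ∣ →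
            Σ (Subset k) λ x → p ⊆ x × x ⊆ q × ∣ x ∣ ≡ r
⊆-between []          []          {zero}  _   _         _   = [] , (λ ()) , (λ ()) , refl
⊆-between (true ∷ p)  (false ∷ q)         p⊆q _         _   with () ← p⊆q here
⊆-between (true ∷ p)  (true ∷ q)  {suc r} p⊆q (s≤s p≤r) (s≤s r≤q)
  with x , p⊆x , x⊆q , ∣x∣≡r ← ⊆-between p q (drop-∷-⊆ p⊆q) p≤r r≤q
  = true ∷ x , in⊆in p⊆x , in⊆in x⊆q , cong suc ∣x∣≡r
⊆-between (false ∷ p) (false ∷ q)         p⊆q p≤r       r≤q
  with x , p⊆x , x⊆q , ∣x∣≡r ← ⊆-between p q (drop-∷-⊆ p⊆q) p≤r r≤q
  = false ∷ x , out⊆ p⊆x , out⊆ x⊆q , ∣x∣≡r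
⊆-between (false ∷ p) (true ∷ q)  {r}     p⊆q p≤r       _   with r ≤? ∣ q ∣
... | yes r≤q with x , p⊆x , x⊆q , ∣x∣≡r ← ⊆-between p q (drop-∷-⊆ p⊆q) p≤r r≤q
  = false ∷ x , out⊆ p⊆x , out⊆ x⊆q , ∣x∣≡r
⊆-between (false ∷ p) (true ∷ q)  {zero}  p⊆q p≤r z≤n       | no r≰q = ⊥-elim (r≰q z≤n)
⊆-between (false ∷ p) (true ∷ q)  {suc r} p⊆q p≤r (s≤s r≤q) | no r≰q
  with x , p⊆x , x⊆q , ∣x∣≡r ←
         ⊆-between p q (drop-∷-⊆ p⊆q) (≤-trans (p⊆q⇒∣p∣≤∣q∣ (drop-∷-⊆ p⊆q)) (≤-pred (≰⇒> r≰q))) r≤q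
  = true ∷ x , out⊆ p⊆x , in⊆in x⊆q , cong suc ∣x∣≡r

⊆-ofSize : (q : Subset k) {r : ℕ} → r ≤ ∣ q ∣ → Σ (Subset k) λ x → x ⊆ q × ∣ x ∣ ≡ r
⊆-ofSize {k} q r≤q
  with x , _ , x⊆q , ∣x∣≡r ← ⊆-between ⊥ q ⊥⊆ (≤-trans (≤-reflexive (∣⊥∣≡0 k)) z≤n) r≤q
  = x , x⊆q , ∣x∣≡r

⋃[_]_ : (Fin m′ → Subset k) → Subset m′ → Subset k
⋃[ f ] []          = ⊥
⋃[ f ] (true ∷ x)  = f zero ∪ ⋃[ f ∘ suc ] x
⋃[ f ] (false ∷ x) = ⋃[ f ∘ suc ] x

x∈⋃⁻ : (f : Fin m′ → Subset k) (x : Subset m′) {v : Fin k} → v ∈ ⋃[ f ] x →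
       Σ (Fin m′) λ i → i ∈ x × v ∈ f i
x∈⋃⁻ f []          v∈ = ⊥-elim (∉⊥ v∈)
x∈⋃⁻ f (true ∷ x)  v∈ with x∈p∪q⁻ (f zero) (⋃[ f ∘ suc ] x) v∈
... | inj₁ v∈f₀ = zero , here , v∈f₀
... | inj₂ v∈⋃ with i , i∈x , v∈fi ← x∈⋃⁻ (f ∘ suc) x v∈⋃ = suc i , there i∈x , v∈fi
x∈⋃⁻ f (false ∷ x) v∈ with i , i∈x , v∈fi ← x∈⋃⁻ (f ∘ suc) x v∈ = suc i , there i∈x , v∈fi

x∈⋃⁺ : (f : Fin m′ → Subset k) (x : Subset m′) {i : Fin m′} {v : Fin k} →
       i ∈ x → v ∈ f i → v ∈ ⋃[ f ] x
x∈⋃⁺ f (true ∷ x)  here       v∈ = x∈p∪q⁺ (inj₁ v∈)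
x∈⋃⁺ f (true ∷ x)  (there i∈) v∈ = x∈p∪q⁺ {p = f zero} (inj₂ (x∈⋃⁺ (f ∘ suc) x i∈ v∈))
x∈⋃⁺ f (false ∷ x) (there i∈) v∈ = x∈⋃⁺ (f ∘ suc) x i∈ v∈

⋃─⊆⋃─ : (f : Fin m′ → Subset k) (x : Subset m′) (a : Subset k) → ⋃[ f ] x ─ a ⊆ ⋃[ (_─ a) ∘ f ] x
⋃─⊆⋃─ f x a v∈ with i , i∈x , v∈fi ← x∈⋃⁻ f x (p─q⊆p _ a v∈)
  = x∈⋃⁺ ((_─ a) ∘ f) x i∈x (x∈p∧x∉q⇒x∈p─q v∈fi (x∈p─q⇒x∉q _ a v∈))

∩⋃⊆⋃∩ : (f : Fin m′ → Subset k) (x : Subset m′) (a : Subset k) → a ∩ ⋃[ f ] x ⊆ ⋃[ (a ∩_) ∘ f ] x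
∩⋃⊆⋃∩ f x a v∈ with v∈a , v∈⋃ ← x∈p∩q⁻ a _ v∈ with i , i∈x , v∈fi ← x∈⋃⁻ f x v∈⋃
  = x∈⋃⁺ ((a ∩_) ∘ f) x i∈x (x∈p∩q⁺ (v∈a , v∈fi))

∣⋃∣≤∣x─y∣ : (f : Fin m′ → Subset k) (x y : Subset m′) →
            (∀ {i} → i ∈ x → ∣ f i ∣ ≤ 1) → (∀ {i} → i ∈ y → ∣ f i ∣ ≡ 0) → ∣ ⋃[ f ] x ∣ ≤ ∣ x ─ y ∣
∣⋃∣≤∣x─y∣ {k = k} f []          []          _           _    = ≤-reflexive (∣⊥∣≡0 k)
∣⋃∣≤∣x─y∣         f (true ∷ x)  (true ∷ y)  at-most-one none =
  ≤-trans (∣p∪q∣≤∣p∣+∣q∣ (f zero) _)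
          (+-mono-≤ (≤-reflexive (none here))
                    (∣⋃∣≤∣x─y∣ (f ∘ suc) x y (at-most-one ∘ there) (none ∘ there)))
∣⋃∣≤∣x─y∣         f (true ∷ x)  (false ∷ y) at-most-one none =
  ≤-trans (∣p∪q∣≤∣p∣+∣q∣ (f zero) _)
          (+-mono-≤ (at-most-one here)
                    (∣⋃∣≤∣x─y∣ (f ∘ suc) x y (at-most-one ∘ there) (none ∘ there)))
∣⋃∣≤∣x─y∣         f (false ∷ x) (true ∷ y)  at-most-one none =
  ∣⋃∣≤∣x─y∣ (f ∘ suc) x y (at-most-one ∘ there) (none ∘ there)
∣⋃∣≤∣x─y∣         f (false ∷ x) (false ∷ y) at-most-one none =
  ∣⋃∣≤∣x─y∣ (f ∘ suc) x y (at-most-one ∘ there) (none ∘ there)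

∣⋃∣≤∣x∣ : (f : Fin m′ → Subset k) (x : Subset m′) →
          (∀ {i} → i ∈ x → ∣ f i ∣ ≤ 1) → ∣ ⋃[ f ] x ∣ ≤ ∣ x ∣
∣⋃∣≤∣x∣ f x at-most-one =
  ≤-trans (∣⋃∣≤∣x─y∣ f x ⊥ at-most-one (⊥-elim ∘ ∉⊥)) (≤-reflexive (cong ∣_∣ (p─⊥≡p x)))

[1+n]C2≡n+nC2 : ∀ n → suc n C 2 ≡ n + n C 2
[1+n]C2≡n+nC2 n = trans (sym (nCk+nC[k+1]≡[n+1]C[k+1] n 1)) (cong (_+ n C 2) (nC1≡n n))

n*n≡n+nC2+nC2 : ∀ n → n * n ≡ n + n C 2 + n C 2
n*n≡n+nC2+nC2 zero    = refl
n*n≡n+nC2+nC2 (suc n) = begin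
  suc n * suc n
    ≡⟨ solve 1 (λ n → (con 1 :+ n) :* (con 1 :+ n) := (con 1 :+ n) :+ n :+ n :* n) refl n ⟩
  suc n + n + n * n
    ≡⟨ cong (suc n + n +_) (n*n≡n+nC2+nC2 n) ⟩
  suc n + n + (n + n C 2 + n C 2)
    ≡⟨ solve 2 (λ n c → (con 1 :+ n) :+ n :+ (n :+ c :+ c) := (con 1 :+ n) :+ (n :+ c) :+ (n :+ c))
               refl n (n C 2) ⟩
  suc n + (n + n C 2) + (n + n C 2)
    ≡⟨ cong (λ c → suc n + c + c) (sym ([1+n]C2≡n+nC2 n)) ⟩
  suc n + suc n C 2 + suc n C 2
    ∎
  where open ≡-Reasoning; open +-*-Solver

LinearFamily : (Fin m′ → Subset k) → Set
LinearFamily f = ∀ i j → i ≢ j → ∣ f i ∩ f j ∣ ≤ 1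

LinearFamily-∘suc : (f : Fin (suc m′) → Subset k) → LinearFamily f → LinearFamily (f ∘ suc)
LinearFamily-∘suc f linear i j i≢j = linear (suc i) (suc j) (i≢j ∘ Fin.suc-injective)

r*∣x∣≤∣⋃x∣+∣x∣C2 : (f : Fin m′ → Subset k) → LinearFamily f → (r : ℕ) → (∀ i → r ≤ ∣ f i ∣) →
                  (x : Subset m′) → r * ∣ x ∣ ≤ ∣ ⋃[ f ] x ∣ + ∣ x ∣ C 2
r*∣x∣≤∣⋃x∣+∣x∣C2 f linear r large []          = ≤-trans (≤-reflexive (*-zeroʳ r)) z≤n
r*∣x∣≤∣⋃x∣+∣x∣C2 f linear r large (false ∷ x) =
  r*∣x∣≤∣⋃x∣+∣x∣C2 (f ∘ suc) (LinearFamily-∘suc f linear) r (large ∘ suc) x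
r*∣x∣≤∣⋃x∣+∣x∣C2 f linear r large (true ∷ x)  = begin
  r * suc ∣ x ∣                      ≡⟨ *-suc r ∣ x ∣ ⟩
  r + r * ∣ x ∣                      ≤⟨ +-mono-≤ (large zero) rest ⟩
  ∣ f₀ ∣ + (∣ ⋃′ ∣ + ∣ x ∣ C 2)       ≡⟨ +-assoc ∣ f₀ ∣ ∣ ⋃′ ∣ _ ⟨
  ∣ f₀ ∣ + ∣ ⋃′ ∣ + ∣ x ∣ C 2         ≡⟨ cong (_+ ∣ x ∣ C 2) (∣p∪q∣+∣p∩q∣≡∣p∣+∣q∣ f₀ ⋃′) ⟨
  W + ∣ f₀ ∩ ⋃′ ∣ + ∣ x ∣ C 2         ≤⟨ +-monoˡ-≤ (∣ x ∣ C 2) (+-monoʳ-≤ W meets-at-most-∣x∣) ⟩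
  W + ∣ x ∣ + ∣ x ∣ C 2               ≡⟨ +-assoc W ∣ x ∣ _ ⟩
  W + (∣ x ∣ + ∣ x ∣ C 2)             ≡⟨ cong (W +_) ([1+n]C2≡n+nC2 ∣ x ∣) ⟨
  W + suc ∣ x ∣ C 2                   ∎
  where
  open ≤-Reasoning
  f₀ = f zero
  ⋃′ = ⋃[ f ∘ suc ] x
  W  = ∣ f₀ ∪ ⋃′ ∣
  rest : r * ∣ x ∣ ≤ ∣ ⋃′ ∣ + ∣ x ∣ C 2
  rest = r*∣x∣≤∣⋃x∣+∣x∣C2 (f ∘ suc) (LinearFamily-∘suc f linear) r (large ∘ suc) x
  meets-at-most-∣x∣ : ∣ f₀ ∩ ⋃′ ∣ ≤ ∣ x ∣
  meets-at-most-∣x∣ = ≤-trans (p⊆q⇒∣p∣≤∣q∣ (∩⋃⊆⋃∩ (f ∘ suc) x f₀))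
                              (∣⋃∣≤∣x∣ _ x (λ {i} _ → linear zero (suc i) λ ()))

r+rC2≤∣⋃x∣ : (f : Fin m′ → Subset k) → LinearFamily f → (r : ℕ) → (∀ i → r ≤ ∣ f i ∣) →
             (x : Subset m′) → ∣ x ∣ ≡ r → r + r C 2 ≤ ∣ ⋃[ f ] x ∣
r+rC2≤∣⋃x∣ f linear r large x refl = +-cancelʳ-≤ (r C 2) _ _ (begin
  r + r C 2 + r C 2   ≡⟨ n*n≡n+nC2+nC2 r ⟨
  r * r               ≤⟨ r*∣x∣≤∣⋃x∣+∣x∣C2 f linear r large x ⟩
  ∣ ⋃[ f ] x ∣ + r C 2 ∎)
  where open ≤-Reasoning

subsetOf : {P : Pred (Fin k) ℓ} → Decidable P → Subset k
subsetOf P? = tabulate (isYes ∘ P?)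

∈subsetOf⁻ : {P : Pred (Fin k) ℓ} (P? : Decidable P) {i : Fin k} → i ∈ subsetOf P? → P i
∈subsetOf⁻ P? {i} i∈ = toWitness {a? = P? i} (Equivalence.from T-≡ isYes≡true)
  where
  isYes≡true : isYes (P? i) ≡ true
  isYes≡true = trans (sym (lookup∘tabulate (isYes ∘ P?) i)) ([]=⇒lookup i∈)

∈subsetOf⁺ : {P : Pred (Fin k) ℓ} (P? : Decidable P) {i : Fin k} → P i → i ∈ subsetOf P?
∈subsetOf⁺ P? {i} Pi =
  lookup⇒[]= i _ (trans (lookup∘tabulate (isYes ∘ P?) i) (Equivalence.to T-≡ (fromWitness Pi)))

module LazyBurning (H : Hypergraph) (B : Subset (n H)) where

  e : Fin (m H) → Subset (n H)
  e = edge H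

  full? : ∀ S → Decidable (λ i → e i ⊆ S)
  full? S i = e i ⊆? S

  -- At most one vertex outside S rather than exactly one, so that Full S ⊆ Ready S.
  ready? : ∀ S → Decidable (λ i → ∣ e i ─ S ∣ ≤ 1)
  ready? S i = ∣ e i ─ S ∣ ≤? 1

  Full : Subset (n H) → Subset (m H)
  Full S = subsetOf (full? S)

  Ready : Subset (n H) → Subset (m H)
  Ready S = subsetOf (ready? S)

  burned : ℕ → Subset (n H)
  burned zero    = B
  burned (suc t) = burned t ∪ ⋃[ e ] Ready (burned t)

  BurnedAt⇒∈burned : ∀ t {v} → BurnedAt H B t v → v ∈ burned t
  BurnedAt⇒∈burned zero    v∈B                         = v∈B
  BurnedAt⇒∈burned (suc t) (inj₁ v-burned)             = x∈p∪q⁺ (inj₁ (BurnedAt⇒∈burned t v-burned))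
  BurnedAt⇒∈burned (suc t) {v} (inj₂ (i , v∈ei , rest-burned)) =
    x∈p∪q⁺ (inj₂ (x∈⋃⁺ e (Ready S) (∈subsetOf⁺ (ready? S) ∣ei─S∣≤1) v∈ei))
    where
    S = burned t
    ei─S⊆⁅v⁆ : e i ─ S ⊆ ⁅ v ⁆
    ei─S⊆⁅v⁆ {u} u∈ with u Fin.≟ v
    ... | yes refl = x∈⁅x⁆ v
    ... | no u≢v   = ⊥-elim (x∈p─q⇒x∉q (e i) S u∈
                       (BurnedAt⇒∈burned t (rest-burned u (p─q⊆p (e i) S u∈) u≢v)))
    ∣ei─S∣≤1 : ∣ e i ─ S ∣ ≤ 1
    ∣ei─S∣≤1 = ≤-trans (p⊆q⇒∣p∣≤∣q∣ ei─S⊆⁅v⁆) (≤-reflexive (∣⁅x⁆∣≡1 v))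

  Full⊆Ready : ∀ S → Full S ⊆ Ready S
  Full⊆Ready S i∈ =
    ∈subsetOf⁺ (ready? S) (≤-trans (≤-reflexive (p⊆q⇒∣p─q∣≡0 _ S (∈subsetOf⁻ (full? S) i∈))) z≤n)

  ⊆Full-∪⋃ : ∀ S x → x ⊆ Full (S ∪ ⋃[ e ] x)
  ⊆Full-∪⋃ S x i∈ = ∈subsetOf⁺ (full? (S ∪ ⋃[ e ] x)) (λ v∈ → x∈p∪q⁺ (inj₂ (x∈⋃⁺ e x i∈ v∈)))

  ⋃Full⊆ : ∀ S x → x ⊆ Full S → ⋃[ e ] x ⊆ S
  ⋃Full⊆ S x x⊆F v∈ with i , i∈x , v∈ei ← x∈⋃⁻ e x v∈ = ∈subsetOf⁻ (full? S) (x⊆F i∈x) v∈ei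

  ∣S∪⋃x∣≤∣S∣+∣x─Full∣ : ∀ S x → x ⊆ Ready S → ∣ S ∪ ⋃[ e ] x ∣ ≤ ∣ S ∣ + ∣ x ─ Full S ∣
  ∣S∪⋃x∣≤∣S∣+∣x─Full∣ S x x⊆R = begin
    ∣ S ∪ ⋃[ e ] x ∣                  ≡⟨ ∣p∪q∣≡∣p∣+∣q─p∣ S _ ⟩
    ∣ S ∣ + ∣ ⋃[ e ] x ─ S ∣          ≤⟨ +-monoʳ-≤ ∣ S ∣ (p⊆q⇒∣p∣≤∣q∣ (⋃─⊆⋃─ e x S)) ⟩
    ∣ S ∣ + ∣ ⋃[ (_─ S) ∘ e ] x ∣     ≤⟨ +-monoʳ-≤ ∣ S ∣ (∣⋃∣≤∣x─y∣ _ x (Full S) at-most-one none) ⟩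
    ∣ S ∣ + ∣ x ─ Full S ∣            ∎
    where
    open ≤-Reasoning
    at-most-one : ∀ {i} → i ∈ x → ∣ e i ─ S ∣ ≤ 1
    at-most-one i∈ = ∈subsetOf⁻ (ready? S) (x⊆R i∈)
    none : ∀ {i} → i ∈ Full S → ∣ e i ─ S ∣ ≡ 0
    none i∈ = p⊆q⇒∣p─q∣≡0 _ S (∈subsetOf⁻ (full? S) i∈)

  ∣S∪⋃x∣≤∣B∣+∣x∣ : ∀ S x → ∣ S ∣ ≤ ∣ B ∣ + ∣ Full S ∣ → Full S ⊆ x → x ⊆ Ready S →
                  ∣ S ∪ ⋃[ e ] x ∣ ≤ ∣ B ∣ + ∣ x ∣
  ∣S∪⋃x∣≤∣B∣+∣x∣ S x ∣S∣≤ F⊆x x⊆R = begin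
    ∣ S ∪ ⋃[ e ] x ∣                   ≤⟨ ∣S∪⋃x∣≤∣S∣+∣x─Full∣ S x x⊆R ⟩
    ∣ S ∣ + ∣ x ─ Full S ∣             ≤⟨ +-monoˡ-≤ ∣ x ─ Full S ∣ ∣S∣≤ ⟩
    ∣ B ∣ + ∣ Full S ∣ + ∣ x ─ Full S ∣ ≡⟨ +-assoc ∣ B ∣ ∣ Full S ∣ _ ⟩
    ∣ B ∣ + (∣ Full S ∣ + ∣ x ─ Full S ∣) ≡⟨ cong (∣ B ∣ +_) (p⊆q⇒∣q∣≡∣p∣+∣q─p∣ (Full S) x F⊆x) ⟨
    ∣ B ∣ + ∣ x ∣                       ∎
    where open ≤-Reasoning

  ∣burned∣≤∣B∣+∣Full∣ : ∀ t → ∣ burned t ∣ ≤ ∣ B ∣ + ∣ Full (burned t) ∣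
  ∣burned∣≤∣B∣+∣Full∣ zero    = m≤m+n ∣ B ∣ _
  ∣burned∣≤∣B∣+∣Full∣ (suc t) =
    ≤-trans (∣S∪⋃x∣≤∣B∣+∣x∣ S (Ready S) (∣burned∣≤∣B∣+∣Full∣ t) (Full⊆Ready S) (λ i∈ → i∈))
            (+-monoʳ-≤ ∣ B ∣ (p⊆q⇒∣p∣≤∣q∣ (⊆Full-∪⋃ S (Ready S))))
    where S = burned t

  SparseEdges : ℕ → Set
  SparseEdges r = Σ (Subset (m H)) λ x → ∣ x ∣ ≡ r × ∣ ⋃[ e ] x ∣ ≤ ∣ B ∣ + r

  sparse-inside : ∀ {r} S → r ≤ ∣ Full S ∣ → ∣ S ∣ ≤ ∣ B ∣ + r → SparseEdges r
  sparse-inside S r≤F ∣S∣≤ with x , x⊆F , ∣x∣≡r ← ⊆-ofSize (Full S) r≤F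
    = x , ∣x∣≡r , ≤-trans (p⊆q⇒∣p∣≤∣q∣ (⋃Full⊆ S x x⊆F)) ∣S∣≤

  -- S is the burned set of the round in which the number of full edges first reaches r.
  sparse-after-step : ∀ {r} S → ∣ S ∣ ≤ ∣ B ∣ + ∣ Full S ∣ → ∣ Full S ∣ ≤ r →
                      r ≤ ∣ Full (S ∪ ⋃[ e ] Ready S) ∣ → SparseEdges r
  sparse-after-step {r} S ∣S∣≤ F≤r r≤F′ with r ≤? ∣ Ready S ∣
  ... | yes r≤R with x , F⊆x , x⊆R , ∣x∣≡r ← ⊆-between (Full S) (Ready S) (Full⊆Ready S) F≤r r≤R
    = x , ∣x∣≡r , (begin
        ∣ ⋃[ e ] x ∣      ≤⟨ ∣q∣≤∣p∪q∣ S _ ⟩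
        ∣ S ∪ ⋃[ e ] x ∣  ≤⟨ ∣S∪⋃x∣≤∣B∣+∣x∣ S x ∣S∣≤ F⊆x x⊆R ⟩
        ∣ B ∣ + ∣ x ∣     ≡⟨ cong (∣ B ∣ +_) ∣x∣≡r ⟩
        ∣ B ∣ + r         ∎)
    where open ≤-Reasoning
  ... | no r≰R = sparse-inside (S ∪ ⋃[ e ] Ready S) r≤F′
                   (≤-trans (∣S∪⋃x∣≤∣B∣+∣x∣ S (Ready S) ∣S∣≤ (Full⊆Ready S) (λ i∈ → i∈))
                            (+-monoʳ-≤ ∣ B ∣ (<⇒≤ (≰⇒> r≰R))))

  sparse-burned : ∀ r t → r ≤ ∣ Full (burned t) ∣ → SparseEdges r
  sparse-burned r zero    r≤F = sparse-inside B r≤F (m≤m+n ∣ B ∣ r)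
  sparse-burned r (suc t) r≤F with r ≤? ∣ Full (burned t) ∣
  ... | yes r≤F₀ = sparse-burned r t r≤F₀
  ... | no r≰F₀  = sparse-after-step (burned t) (∣burned∣≤∣B∣+∣Full∣ t) (<⇒≤ (≰⇒> r≰F₀)) r≤F

  lazyBurningSet⇒sparse : ∀ r → r ≤ m H → IsLazyBurningSet H B → SparseEdges r
  lazyBurningSet⇒sparse r r≤m (t , all-burned) = sparse-burned r t (≤-trans r≤m all-full)
    where
    ⊤⊆Full : ⊤ ⊆ Full (burned t)
    ⊤⊆Full _ = ∈subsetOf⁺ (full? (burned t)) (λ {v} _ → BurnedAt⇒∈burned t (all-burned v))
    all-full : m H ≤ ∣ Full (burned t) ∣
    all-full = subst (_≤ ∣ Full (burned t) ∣) (∣⊤∣≡n (m H)) (p⊆q⇒∣p∣≤∣q∣ ⊤⊆Full)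

theorem2p11 : (r : ℕ) (H : Hypergraph) → Linear H
            → (∀ i → r ≤ ∣ edge H i ∣) → r ≤ m H
            → LazyBurningNumber≥ H (r C 2)
theorem2p11 r H linear large r≤m B burns
  with x , ∣x∣≡r , ∣⋃x∣≤ ← LazyBurning.lazyBurningSet⇒sparse H B r r≤m burns
  = +-cancelˡ-≤ r (r C 2) ∣ B ∣ (begin
      r + r C 2          ≤⟨ r+rC2≤∣⋃x∣ (edge H) linear r large x ∣x∣≡r ⟩
      ∣ ⋃[ edge H ] x ∣  ≤⟨ ∣⋃x∣≤ ⟩
      ∣ B ∣ + r          ≡⟨ +-comm ∣ B ∣ r ⟩
      r + ∣ B ∣          ∎)
  where open ≤-Reasoning
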